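{- Let $s\geq 2$, $t\geq 1$, $n, r\geq 1$ be integers. Suppose the edges of $K_{n,n}$, with vertex set $U\sqcup V$ ($|U|=|V|=n$), are colored with $r$ colors such that there is no monochromatic subgraph isomorphic to $K_{s,t}$. Suppose positive integers $m,d$ satisfy \[\left(\frac{m}{s-1}\right)^{1/t}(d-t+1)>n.\] Then fewer than $mr$ vertices of $U$, and fewer than $mr$ vertices of $V$, are incident to at least $d$ edges of one and the same color.
   Context: A subgraph is monochromatic if all its edges have the same color. -}

module Defs where

open import Data.Nat using (ℕ; _≤_; _≤?_)
open import Data.Fin using (Fin; _≟_)
open import Data.Fin.Properties using (any?)
open import Data.List using (List; length; filter; allFin)
open import Data.Product using (Σ; ∃; _×_)
open import Function.Definitions using (Injective)
open import Relation.Binary.PropositionalEquality using (_≡_)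
open import Relation.Nullary using (Dec)

-- A coloring of the edges of K_{n,n} with r colors: vertex sets U = V = Fin n,
-- the edge {u,v} (u ∈ U, v ∈ V) receives color  χ u v.
Coloring : ℕ → ℕ → Set
Coloring n r = Fin n → Fin n → Fin r

MonoKstUV : ∀ {n r} → ℕ → ℕ → Coloring n r → Set
MonoKstUV {n} {r} s t χ =
  Σ (Fin r) λ k → Σ (Fin s → Fin n) λ f → Σ (Fin t → Fin n) λ g →
    Injective _≡_ _≡_ f × Injective _≡_ _≡_ g × (∀ i j → χ (f i) (g j) ≡ k)

MonoKstVU : ∀ {n r} → ℕ → ℕ → Coloring n r → Set
MonoKstVU {n} {r} s t χ =
  Σ (Fin r) λ k → Σ (Fin s → Fin n) λ f → Σ (Fin t → Fin n) λ g →
    Injective _≡_ _≡_ f × Injective _≡_ _≡_ g × (∀ i j → χ (g j) (f i) ≡ k)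

degU : ∀ {n r} → Coloring n r → Fin n → Fin r → ℕ
degU {n} χ u k = length (filter (λ v → χ u v ≟ k) (allFin n))

degV : ∀ {n r} → Coloring n r → Fin n → Fin r → ℕ
degV {n} χ v k = length (filter (λ u → χ u v ≟ k) (allFin n))

richU? : ∀ {n r} (χ : Coloring n r) (d : ℕ) (u : Fin n) → Dec (∃ λ k → d ≤ degU χ u k)
richU? χ d u = any? (λ k → d ≤? degU χ u k)

richV? : ∀ {n r} (χ : Coloring n r) (d : ℕ) (v : Fin n) → Dec (∃ λ k → d ≤ degV χ v k)
richV? χ d v = any? (λ k → d ≤? degV χ v k)

numRichU : ∀ {n r} → Coloring n r → ℕ → ℕ
numRichU {n} χ d = length (filter (richU? χ d) (allFin n))

numRichV : ∀ {n r} → Coloring n r → ℕ → ℕ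
numRichV {n} χ d = length (filter (richV? χ d) (allFin n))

-- The heart is a Kővári–Sós–Turán type count, by induction on t. Let E be a
-- bipartite relation with no K_{s,t} whose s-side lies in A, and let every
-- vertex of A have degree at least d. Counting the edges leaving A gives
-- |A| (d - t + 1) ≤ Σ_v |A ∩ N(v)|. For a fixed v, the vertices of A ∩ N(v)
-- still have degree at least d - 1 once v is deleted, and a K_{s,t-1} in what
-- remains would extend by v to a K_{s,t}; so by induction each term satisfies
-- |A ∩ N(v)| (d - t + 1)^(t-1) ≤ (s - 1) n^(t-1). Summing over v gives
-- |A| (d - t + 1)^t ≤ (s - 1) n^t, which together with the hypothesis on m
-- forces |A| < m. Taking for A the vertices with at least d edges of colour k,
-- and summing over the r colours, proves the theorem.
module Submission where

open import Defs
open import Data.Nat using (ℕ; zero; suc; _≤_; _<_; _*_; _^_; _+_; _∸_; z≤n; s≤s; s≤s⁻¹; _≤?_)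
open import Data.Nat.Properties hiding (_≟_; suc-injective)
open import Algebra.Properties.CommutativeSemigroup *-commutativeSemigroup using (x∙yz≈y∙xz)
open import Algebra.Properties.Semiring.Sum +-*-semiring
  using (sum; sum-syntax; sum-remove; sum-replicate-zero; ∑-comm; ∑-distrib-+; *-distribʳ-sum)
open import Data.Bool using (true; false; if_then_else_)
open import Data.Empty using (⊥-elim)
open import Data.Fin using (Fin; zero; suc; _≟_)
open import Data.Fin.Properties using (any?; suc-injective)
open import Data.List using (length; filter; tabulate; allFin)
open import Data.Product using (Σ-syntax; _×_; _,_; proj₁; proj₂)
open import Data.Vec.Functional using (_∷_)
open import Function using (id; _∘_; flip)
open import Function.Definitions using (Injective)
open import Level using (0ℓ)
open import Relation.Binary using (REL)
open import Relation.Binary.PropositionalEquality using (_≡_; _≢_; refl; sym; cong; subst)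
open import Relation.Nullary using (¬_; Dec; yes; no; does; ¬?; contradiction)
open import Relation.Nullary.Decidable using (_×-dec_; dec-true)
open import Relation.Unary using (Pred; Decidable)

indicator : ∀ {p} {P : Set p} → Dec P → ℕ
indicator P? = if does P? then 1 else 0

indicator-yes : ∀ {p} {P : Set p} (P? : Dec P) → P → indicator P? ≡ 1
indicator-yes P? p rewrite dec-true P? p = refl

count : ∀ {n p} {P : Pred (Fin n) p} → Decidable P → ℕ
count {n} P? = ∑[ i < n ] indicator (P? i)

length-filter-tabulate : ∀ {a p} {A : Set a} {P : Pred A p} (P? : Decidable P) {n} (f : Fin n → A) →
                         length (filter P? (tabulate f)) ≡ ∑[ i < n ] indicator (P? (f i))
length-filter-tabulate P? {zero}  f = refl
length-filter-tabulate P? {suc n} f with does (P? (f zero))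
... | true  = cong suc (length-filter-tabulate P? (f ∘ suc))
... | false = length-filter-tabulate P? (f ∘ suc)

length-filter-allFin : ∀ {n p} {P : Pred (Fin n) p} (P? : Decidable P) →
                       length (filter P? (allFin n)) ≡ count P?
length-filter-allFin P? = length-filter-tabulate P? id

∑-mono-≤ : ∀ {n} {f g : Fin n → ℕ} → (∀ i → f i ≤ g i) → sum f ≤ sum g
∑-mono-≤ {zero}  f≤g = z≤n
∑-mono-≤ {suc n} f≤g = +-mono-≤ (f≤g zero) (∑-mono-≤ (f≤g ∘ suc))

∑-mono-< : ∀ {n} {f g : Fin (suc n) → ℕ} → (∀ i → f i < g i) → sum f < sum g
∑-mono-< f<g = +-mono-<-≤ (f<g zero) (∑-mono-≤ (<⇒≤ ∘ f<g ∘ suc))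

∑-const : ∀ n c → ∑[ i < n ] c ≡ n * c
∑-const zero    c = refl
∑-const (suc n) c = cong (c +_) (∑-const n c)

lookup≤∑ : ∀ {n} (f : Fin n → ℕ) i → f i ≤ sum f
lookup≤∑ {suc n} f i = ≤-trans (m≤m+n (f i) _) (≤-reflexive (sym (sum-remove {i = i} f)))

indicator-any≤count : ∀ {n p} {P : Pred (Fin n) p} (P? : Decidable P) → indicator (any? P?) ≤ count P?
indicator-any≤count P? with any? P?
... | yes (i , p) = subst (_≤ count P?) (indicator-yes (P? i) p) (lookup≤∑ _ i)
... | no _        = z≤n

count-any≤∑-count : ∀ {n r} {R : Fin n → Fin r → Set} (R? : ∀ u k → Dec (R u k)) →
                    count (λ u → any? (R? u)) ≤ ∑[ k < r ] count (λ u → R? u k)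
count-any≤∑-count {n} {r} R? = begin
  count (λ u → any? (R? u))                   ≤⟨ ∑-mono-≤ (λ u → indicator-any≤count (R? u)) ⟩
  ∑[ u < n ] ∑[ k < r ] indicator (R? u k)    ≡⟨ ∑-comm (λ u k → indicator (R? u k)) ⟩
  ∑[ k < r ] count (λ u → R? u k)             ∎
  where open ≤-Reasoning

count-≟ : ∀ {n} (v : Fin n) → count (_≟ v) ≡ 1
count-≟ {suc n} zero = cong suc (sum-replicate-zero n)
count-≟ (suc v)      = count-≟ v

count≤suc-count-except : ∀ {n p} {P : Pred (Fin n) p} (P? : Decidable P) (v : Fin n) →
                         count P? ≤ suc (count (λ w → P? w ×-dec ¬? (w ≟ v)))
count≤suc-count-except {n} {P = P} P? v = begin
  count P?                                               ≤⟨ ∑-mono-≤ split ⟩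
  ∑[ w < n ] (indicator (P?∖v w) + indicator (w ≟ v))   ≡⟨ ∑-distrib-+ (indicator ∘ P?∖v) (indicator ∘ (_≟ v)) ⟩
  count P?∖v + count (_≟ v)                              ≡⟨ cong (count P?∖v +_) (count-≟ v) ⟩
  count P?∖v + 1                                         ≡⟨ +-comm (count P?∖v) 1 ⟩
  suc (count P?∖v)                                       ∎
  where
  open ≤-Reasoning
  P?∖v : Decidable (λ w → P w × w ≢ v)
  P?∖v w = P? w ×-dec ¬? (w ≟ v)

  split : ∀ w → indicator (P? w) ≤ indicator (P? w ×-dec ¬? (w ≟ v)) + indicator (w ≟ v)
  split w with P? w | w ≟ v
  ... | yes _ | yes _ = ≤-refl
  ... | yes _ | no _  = ≤-refl
  ... | no _  | _     = z≤n

cons-injective : ∀ {a} {A : Set a} {n} {x : A} {g : Fin n → A} →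
                 (∀ j → g j ≢ x) → Injective _≡_ _≡_ g → Injective _≡_ _≡_ (x ∷ g)
cons-injective x∉g g-inj {zero}  {zero}  _  = refl
cons-injective x∉g g-inj {zero}  {suc j} eq = contradiction (sym eq) (x∉g j)
cons-injective x∉g g-inj {suc i} {zero}  eq = contradiction eq (x∉g i)
cons-injective x∉g g-inj {suc i} {suc j} eq = cong suc (g-inj eq)

injection-of-count : ∀ {n p} {P : Pred (Fin n) p} (P? : Decidable P) {s} → s ≤ count P? →
                     Σ[ f ∈ (Fin s → Fin n) ] Injective _≡_ _≡_ f × (∀ i → P (f i))
injection-of-count P? {zero} _ = (λ ()) , (λ { {()} }) , (λ ())
injection-of-count {suc n} P? {suc s} s<count with P? zero
... | no _ =
  let f , f-inj , Pf = injection-of-count (P? ∘ suc) s<count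
  in suc ∘ f , f-inj ∘ suc-injective , Pf
... | yes P0 =
  let f , f-inj , Pf = injection-of-count (P? ∘ suc) (s≤s⁻¹ s<count)
  in zero ∷ suc ∘ f , cons-injective (λ _ ()) (f-inj ∘ suc-injective) , λ { zero → P0 ; (suc i) → Pf i }

HasKst : ∀ {a n} (s t : ℕ) → Pred (Fin a) 0ℓ → REL (Fin a) (Fin n) 0ℓ → Set
HasKst {a} {n} s t A E =
  Σ[ f ∈ (Fin s → Fin a) ] Σ[ g ∈ (Fin t → Fin n) ]
    Injective _≡_ _≡_ f × Injective _≡_ _≡_ g × (∀ i → A (f i)) × (∀ i j → E (f i) (g j))

HasKst-extend : ∀ {a n s t} {A : Pred (Fin a) 0ℓ} {E : REL (Fin a) (Fin n) 0ℓ} (v : Fin n) →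
                HasKst (suc s) t (λ u → A u × E u v) (λ u w → E u w × w ≢ v) →
                HasKst (suc s) (suc t) A E
HasKst-extend v (f , g , f-inj , g-inj , Af , Efg) =
  f , v ∷ g , f-inj , cons-injective (λ j → proj₂ (Efg zero j)) g-inj , proj₁ ∘ Af ,
  λ { i zero → proj₂ (Af i) ; i (suc j) → proj₁ (Efg i j) }

Ks0-free⇒count≤ : ∀ {a n s} {A : Pred (Fin a) 0ℓ} {E : REL (Fin a) (Fin n) 0ℓ} (A? : Decidable A) →
                  ¬ HasKst (suc s) 0 A E → count A? ≤ s
Ks0-free⇒count≤ {s = s} A? noK with count A? ≤? s
... | yes count≤s = count≤s
... | no count≰s with injection-of-count A? (≰⇒> count≰s)
...   | f , f-inj , Af = ⊥-elim (noK (f , (λ ()) , f-inj , (λ { {()} }) , Af , λ _ ()))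

Kst-free⇒count-bound : ∀ {a n} s t d {A : Pred (Fin a) 0ℓ} {E : REL (Fin a) (Fin n) 0ℓ}
                       (A? : Decidable A) (E? : ∀ u w → Dec (E u w)) →
                       ¬ HasKst (suc s) t A E → (∀ u → A u → d ≤ count (E? u)) →
                       count A? * (d + 1 ∸ t) ^ t ≤ s * n ^ t
Kst-free⇒count-bound s zero d {E = E} A? E? noK _ = *-monoˡ-≤ 1 (Ks0-free⇒count≤ {E = E} A? noK)
Kst-free⇒count-bound s (suc t) zero A? E? _ _ rewrite 0∸n≡0 t | *-zeroʳ (count A?) = z≤n
Kst-free⇒count-bound {a} {n} s (suc t) (suc d) {A} {E} A? E? noK deg≥ = begin
  count A? * (Y * Y ^ t)                    ≡⟨ *-assoc (count A?) Y (Y ^ t) ⟨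
  count A? * Y * Y ^ t                      ≤⟨ *-monoˡ-≤ (Y ^ t) double-count ⟩
  (∑[ v < n ] count (Aᵥ? v)) * Y ^ t        ≡⟨ *-distribʳ-sum (Y ^ t) (count ∘ Aᵥ?) ⟩
  ∑[ v < n ] (count (Aᵥ? v) * Y ^ t)        ≤⟨ ∑-mono-≤ bound-at ⟩
  ∑[ v < n ] (s * n ^ t)                    ≡⟨ ∑-const n (s * n ^ t) ⟩
  n * (s * n ^ t)                           ≡⟨ x∙yz≈y∙xz n s (n ^ t) ⟩
  s * (n * n ^ t)                           ∎
  where
  open ≤-Reasoning
  Y : ℕ
  Y = d + 1 ∸ t

  Aᵥ? : ∀ v → Decidable (λ u → A u × E u v)
  Aᵥ? v u = A? u ×-dec E? u v

  Y≤1+d : Y ≤ suc d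
  Y≤1+d = ≤-trans (m∸n≤m (d + 1) t) (≤-reflexive (+-comm d 1))

  row : ∀ u → indicator (A? u) * Y ≤ ∑[ v < n ] indicator (A? u ×-dec E? u v)
  row u with A? u
  ... | yes Au = ≤-trans (≤-reflexive (+-identityʳ Y)) (≤-trans Y≤1+d (deg≥ u Au))
  ... | no _   = z≤n

  double-count : count A? * Y ≤ ∑[ v < n ] count (Aᵥ? v)
  double-count = begin
    count A? * Y                                   ≡⟨ *-distribʳ-sum Y (indicator ∘ A?) ⟩
    ∑[ u < a ] (indicator (A? u) * Y)              ≤⟨ ∑-mono-≤ row ⟩
    ∑[ u < a ] ∑[ v < n ] indicator (Aᵥ? v u)      ≡⟨ ∑-comm (λ u v → indicator (Aᵥ? v u)) ⟩
    ∑[ v < n ] count (Aᵥ? v)                       ∎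

  bound-at : ∀ v → count (Aᵥ? v) * Y ^ t ≤ s * n ^ t
  bound-at v = Kst-free⇒count-bound s t d (Aᵥ? v) (λ u w → E? u w ×-dec ¬? (w ≟ v))
    (noK ∘ HasKst-extend {A = A} {E = E} v)
    (λ u (Au , _) → s≤s⁻¹ (≤-trans (deg≥ u Au) (count≤suc-count-except (E? u) v)))

count-rich<m*r : ∀ {n r} s t m d {E : Fin (suc r) → REL (Fin n) (Fin n) 0ℓ} (E? : ∀ k u w → Dec (E k u w))
                 {R : Fin n → Fin (suc r) → Set} (R? : ∀ u k → Dec (R u k)) →
                 (∀ u k → R u k → d ≤ count (E? k u)) →
                 (∀ k → ¬ HasKst (suc s) t (λ u → R u k) (E k)) →
                 s * n ^ t < m * (d + 1 ∸ t) ^ t →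
                 count (λ u → any? (R? u)) < m * suc r
count-rich<m*r {r = r} s t m d E? R? rich⇒deg≥ noK s*n^t<m*Y^t = begin-strict
  count (λ u → any? (R? u))                ≤⟨ count-any≤∑-count R? ⟩
  ∑[ k < suc r ] count (λ u → R? u k)      <⟨ ∑-mono-< few-rich-in ⟩
  ∑[ k < suc r ] m                         ≡⟨ ∑-const (suc r) m ⟩
  suc r * m                                ≡⟨ *-comm (suc r) m ⟩
  m * suc r                                ∎
  where
  open ≤-Reasoning
  few-rich-in : ∀ k → count (λ u → R? u k) < m
  few-rich-in k = *-cancelʳ-< _ _ m (≤-<-trans
    (Kst-free⇒count-bound s t d (λ u → R? u k) (E? k) (noK k) (λ u → rich⇒deg≥ u k))
    s*n^t<m*Y^t)

numRichU<m*r : ∀ {n r} s t m d (χ : Coloring n (suc r)) → ¬ MonoKstUV (suc s) t χ →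
               s * n ^ t < m * (d + 1 ∸ t) ^ t → numRichU χ d < m * suc r
numRichU<m*r {r = r} s t m d χ noK s*n^t<m*Y^t =
  subst (_< m * suc r) (sym (length-filter-allFin (richU? χ d)))
    (count-rich<m*r s t m d (λ k u v → χ u v ≟ k) (λ u k → d ≤? degU χ u k)
      rich⇒deg≥ noKₖ s*n^t<m*Y^t)
  where
  rich⇒deg≥ : ∀ u k → d ≤ degU χ u k → d ≤ count (λ v → χ u v ≟ k)
  rich⇒deg≥ u k = subst (d ≤_) (length-filter-allFin (λ v → χ u v ≟ k))

  noKₖ : ∀ k → ¬ HasKst (suc s) t (λ u → d ≤ degU χ u k) (λ u v → χ u v ≡ k)
  noKₖ k (f , g , f-inj , g-inj , _ , mono) = noK (k , f , g , f-inj , g-inj , mono)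

-- The V side is, definitionally, the U side of the transposed colouring flip χ.
lemma2 : (s t n r m d : ℕ) → 2 ≤ s → 1 ≤ t → 1 ≤ n → 1 ≤ r → 1 ≤ m → 1 ≤ d →
         (χ : Coloring n r) →
         ¬ MonoKstUV s t χ → ¬ MonoKstVU s t χ →
         t ≤ d → (s ∸ 1) * n ^ t < m * (d + 1 ∸ t) ^ t →
         (numRichU χ d < m * r) × (numRichV χ d < m * r)
lemma2 (suc s) t n (suc r) m d (s≤s _) _ _ (s≤s _) _ _ χ noUV noVU _ ineq =
  numRichU<m*r s t m d χ noUV ineq , numRichU<m*r s t m d (flip χ) noVU ineq
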